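{- For all $n\ge 2$, $$c_n^{1\text{ - }2}=d_n^{1\text{ - }2}=2\cdot 4^{n-2}+(n-2)\cdot 2^{n-2},\qquad c_n^{2\text{ - }1}=d_n^{2\text{ - }1}=2\cdot 4^{n-2}-n\cdot 2^{n-2}.$$
   Context: The sigma-words are the words over $\{1,2\}$ defined by $C_1=1$, $D_1=2$, $C_{k+1}=C_k1D_k$, $D_{k+1}=C_k2D_k$ for $k\ge1$. An occurrence of the pattern $1\text{ - }2$ (resp. $2\text{ - }1$) in a word $w=w_1\cdots w_N$ over $\{1,2\}$ is a pair of indices $i<j$ with $w_i=1,w_j=2$ (resp. $w_i=2,w_j=1$); the letters need not be adjacent. $c_n^{\tau}$ and $d_n^{\tau}$ denote the number of occurrences of the pattern $\tau$ in $C_n$ and in $D_n$ respectively. -}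

module Defs where

open import Data.Nat using (ℕ; zero; suc; _+_)
open import Data.List using (List; []; _∷_; _++_; [_])

data Letter : Set where
  one two : Letter

-- sigma-words: C n, D n are C_n, D_n for n ≥ 1 (C_1 = 1, D_1 = 2,
-- C_{k+1} = C_k 1 D_k, D_{k+1} = C_k 2 D_k); index 0 is an unused junk value.
mutual
  C : ℕ → List Letter
  C zero          = [ one ]
  C (suc zero)    = [ one ]
  C (suc (suc k)) = C (suc k) ++ (one ∷ D (suc k))

  D : ℕ → List Letter
  D zero          = [ two ]
  D (suc zero)    = [ two ]
  D (suc (suc k)) = C (suc k) ++ (two ∷ D (suc k))

countL : Letter → List Letter → ℕ
countL b [] = 0
countL one (one ∷ w) = suc (countL one w)
countL one (two ∷ w) = countL one w
countL two (two ∷ w) = suc (countL two w)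
countL two (one ∷ w) = countL two w

-- occurrences of the (non-consecutive) pattern a-b in w:
-- number of index pairs i < j with w_i = a and w_j = b
occ : Letter → Letter → List Letter → ℕ
occ a b [] = 0
occ one b (one ∷ w) = countL b w + occ one b w
occ two b (two ∷ w) = countL b w + occ two b w
occ one b (two ∷ w) = occ one b w
occ two b (one ∷ w) = occ two b w

{-# OPTIONS --safe #-}
-- Splitting a word w = u ++ v gives occ a b w = occ a b u + occ a b v + #a u · #b v, and C_k
-- (resp. D_k) contains 2^(k-1) ones (twos) and 2^(k-1) - 1 letters of the other kind. As
-- #1 C_k = #2 D_k, the middle letter of C_{k+1} and D_{k+1} does not change their 1-2 count,
-- which therefore satisfies c_{k+1} = 2 c_k + 2^(k-1) (2^(k-1) + 1). The 2-1 count follows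
-- from occ 1 2 w + occ 2 1 w = #1 w · #2 w.
module Submission where

open import Defs
open import Data.Nat using (ℕ; zero; suc; _+_; _*_; _∸_; _^_; _≥_; s≤s)
open import Data.Nat.Properties
  using (+-identityʳ; +-suc; +-comm; +-assoc; *-suc; +-cancelʳ-≡; ^-*-assoc; ^-distribˡ-+-*)
open import Data.Nat.Tactic.RingSolver using (solve; solve-∀)
open import Data.List using (List; []; _∷_; _++_)
open import Data.Product using (_×_; _,_)
open import Relation.Binary.PropositionalEquality using (_≡_; refl; sym; trans; cong; cong₂; module ≡-Reasoning)
open ≡-Reasoning

countL-++ : ∀ b u v → countL b (u ++ v) ≡ countL b u + countL b v
countL-++ b   []        v = refl
countL-++ one (one ∷ u) v = cong suc (countL-++ one u v)
countL-++ one (two ∷ u) v = countL-++ one u v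
countL-++ two (two ∷ u) v = cong suc (countL-++ two u v)
countL-++ two (one ∷ u) v = countL-++ two u v

private
  occ-∷-++ : ∀ {cu cv cuv ou ov ouv} k → cuv ≡ cu + cv → ouv ≡ ou + ov + k * cv →
             cuv + ouv ≡ cu + ou + ov + suc k * cv
  occ-∷-++ {cu} {cv} {ou = ou} {ov} k refl refl = solve (cu ∷ cv ∷ ou ∷ ov ∷ k ∷ [])

occ-++ : ∀ a b u v → occ a b (u ++ v) ≡ occ a b u + occ a b v + countL a u * countL b v
occ-++ a   b []        v = sym (+-identityʳ _)
occ-++ one b (one ∷ u) v = occ-∷-++ (countL one u) (countL-++ b u v) (occ-++ one b u v)
occ-++ one b (two ∷ u) v = occ-++ one b u v
occ-++ two b (two ∷ u) v = occ-∷-++ (countL two u) (countL-++ b u v) (occ-++ two b u v)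
occ-++ two b (one ∷ u) v = occ-++ two b u v

2^n+2^n≡2^1+n : ∀ n → 2 ^ n + 2 ^ n ≡ 2 ^ suc n
2^n+2^n≡2^1+n n = cong (2 ^ n +_) (sym (+-identityʳ (2 ^ n)))

4^n≡2^n*2^n : ∀ n → 4 ^ n ≡ 2 ^ n * 2 ^ n
4^n≡2^n*2^n n = begin
  4 ^ n             ≡⟨ ^-*-assoc 2 2 n ⟩
  2 ^ (n + (n + 0)) ≡⟨ cong (λ k → 2 ^ (n + k)) (+-identityʳ n) ⟩
  2 ^ (n + n)       ≡⟨ ^-distribˡ-+-* 2 n n ⟩
  2 ^ n * 2 ^ n     ∎

mutual
  countL-one-C : ∀ n → countL one (C (suc n)) ≡ 2 ^ n
  countL-one-C zero    = refl
  countL-one-C (suc n) = begin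
    countL one (C (suc n) ++ one ∷ D (suc n))             ≡⟨ countL-++ one (C (suc n)) _ ⟩
    countL one (C (suc n)) + suc (countL one (D (suc n))) ≡⟨ cong₂ _+_ (countL-one-C n) (countL-one-D n) ⟩
    2 ^ n + 2 ^ n                                         ≡⟨ 2^n+2^n≡2^1+n n ⟩
    2 ^ suc n                                             ∎

  countL-two-C : ∀ n → suc (countL two (C (suc n))) ≡ 2 ^ n
  countL-two-C zero    = refl
  countL-two-C (suc n) = begin
    suc (countL two (C (suc n) ++ one ∷ D (suc n)))       ≡⟨ cong suc (countL-++ two (C (suc n)) _) ⟩
    suc (countL two (C (suc n))) + countL two (D (suc n)) ≡⟨ cong₂ _+_ (countL-two-C n) (countL-two-D n) ⟩
    2 ^ n + 2 ^ n                                         ≡⟨ 2^n+2^n≡2^1+n n ⟩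
    2 ^ suc n                                             ∎

  countL-one-D : ∀ n → suc (countL one (D (suc n))) ≡ 2 ^ n
  countL-one-D zero    = refl
  countL-one-D (suc n) = begin
    suc (countL one (C (suc n) ++ two ∷ D (suc n)))       ≡⟨ cong suc (countL-++ one (C (suc n)) _) ⟩
    suc (countL one (C (suc n)) + countL one (D (suc n))) ≡⟨ sym (+-suc _ _) ⟩
    countL one (C (suc n)) + suc (countL one (D (suc n))) ≡⟨ cong₂ _+_ (countL-one-C n) (countL-one-D n) ⟩
    2 ^ n + 2 ^ n                                         ≡⟨ 2^n+2^n≡2^1+n n ⟩
    2 ^ suc n                                             ∎

  countL-two-D : ∀ n → countL two (D (suc n)) ≡ 2 ^ n
  countL-two-D zero    = refl
  countL-two-D (suc n) = begin
    countL two (C (suc n) ++ two ∷ D (suc n))             ≡⟨ countL-++ two (C (suc n)) _ ⟩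
    countL two (C (suc n)) + suc (countL two (D (suc n))) ≡⟨ +-suc _ _ ⟩
    suc (countL two (C (suc n))) + countL two (D (suc n)) ≡⟨ cong₂ _+_ (countL-two-C n) (countL-two-D n) ⟩
    2 ^ n + 2 ^ n                                         ≡⟨ 2^n+2^n≡2^1+n n ⟩
    2 ^ suc n                                             ∎

countL-one*two-C : ∀ n → countL one (C (suc n)) * countL two (C (suc n)) + 2 ^ n ≡ 2 ^ n * 2 ^ n
countL-one*two-C n = begin
  a * b + 2 ^ n     ≡⟨ cong (λ c → c * b + 2 ^ n) (countL-one-C n) ⟩
  2 ^ n * b + 2 ^ n ≡⟨ +-comm (2 ^ n * b) _ ⟩
  2 ^ n + 2 ^ n * b ≡⟨ sym (*-suc (2 ^ n) b) ⟩
  2 ^ n * suc b     ≡⟨ cong (2 ^ n *_) (countL-two-C n) ⟩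
  2 ^ n * 2 ^ n     ∎
  where
  a = countL one (C (suc n))
  b = countL two (C (suc n))

countL-one*two-D : ∀ n → countL one (D (suc n)) * countL two (D (suc n)) + 2 ^ n ≡ 2 ^ n * 2 ^ n
countL-one*two-D n = begin
  a * b + 2 ^ n ≡⟨ cong (a * b +_) (sym (countL-two-D n)) ⟩
  a * b + b     ≡⟨ +-comm (a * b) b ⟩
  suc a * b     ≡⟨ cong₂ _*_ (countL-one-D n) (countL-two-D n) ⟩
  2 ^ n * 2 ^ n ∎
  where
  a = countL one (D (suc n))
  b = countL two (D (suc n))

occ-one-two+occ-two-one : ∀ w → occ one two w + occ two one w ≡ countL one w * countL two w
occ-one-two+occ-two-one []        = refl
occ-one-two+occ-two-one (one ∷ w) = begin
  countL two w + occ one two w + occ two one w   ≡⟨ +-assoc (countL two w) _ _ ⟩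
  countL two w + (occ one two w + occ two one w) ≡⟨ cong (countL two w +_) (occ-one-two+occ-two-one w) ⟩
  countL two w + countL one w * countL two w     ∎
occ-one-two+occ-two-one (two ∷ w) = begin
  occ one two w + (countL one w + occ two one w) ≡⟨ x+[y+z]≡y+[x+z] (occ one two w) (countL one w) (occ two one w) ⟩
  countL one w + (occ one two w + occ two one w) ≡⟨ cong (countL one w +_) (occ-one-two+occ-two-one w) ⟩
  countL one w + countL one w * countL two w     ≡⟨ sym (*-suc (countL one w) _) ⟩
  countL one w * suc (countL two w)              ∎
  where
  x+[y+z]≡y+[x+z] : ∀ x y z → x + (y + z) ≡ y + (x + z)
  x+[y+z]≡y+[x+z] = solve-∀

occ-one-two-middle : ∀ u v → countL one u ≡ countL two v →
                     occ one two (u ++ one ∷ v) ≡ occ one two (u ++ two ∷ v)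
occ-one-two-middle u v eq = begin
  occ one two (u ++ one ∷ v)
    ≡⟨ occ-++ one two u _ ⟩
  occ one two u + (countL two v + occ one two v) + countL one u * countL two v
    ≡⟨ rearrange (occ one two u) (occ one two v) eq ⟩
  occ one two u + occ one two v + countL one u * suc (countL two v)
    ≡⟨ sym (occ-++ one two u _) ⟩
  occ one two (u ++ two ∷ v)
    ∎
  where
  rearrange : ∀ x y {c d} → c ≡ d → x + (d + y) + c * d ≡ x + y + c * suc d
  rearrange x y {c} refl = solve (x ∷ y ∷ c ∷ [])

occ-one-two-C≡D : ∀ n → occ one two (C n) ≡ occ one two (D n)
occ-one-two-C≡D zero          = refl
occ-one-two-C≡D (suc zero)    = refl
occ-one-two-C≡D (suc (suc n)) =
  occ-one-two-middle (C (suc n)) (D (suc n)) (trans (countL-one-C n) (sym (countL-two-D n)))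

occ-one-two-C-step : ∀ n → let x = occ one two (C (suc n)) in
                     occ one two (C (2 + n)) ≡ x + (2 ^ n + x) + 2 ^ n * 2 ^ n
occ-one-two-C-step n = begin
  occ one two (Cₙ ++ one ∷ Dₙ)
    ≡⟨ occ-++ one two Cₙ _ ⟩
  occ one two Cₙ + (countL two Dₙ + occ one two Dₙ) + countL one Cₙ * countL two Dₙ
    ≡⟨ cong₂ (λ c d → occ one two Cₙ + (d + occ one two Dₙ) + c * d) (countL-one-C n) (countL-two-D n) ⟩
  occ one two Cₙ + (2 ^ n + occ one two Dₙ) + 2 ^ n * 2 ^ n
    ≡⟨ cong (λ y → occ one two Cₙ + (2 ^ n + y) + 2 ^ n * 2 ^ n) (sym (occ-one-two-C≡D (suc n))) ⟩
  occ one two Cₙ + (2 ^ n + occ one two Cₙ) + 2 ^ n * 2 ^ n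
    ∎
  where
  Cₙ = C (suc n)
  Dₙ = D (suc n)

occ-one-two-C : ∀ m → occ one two (C (2 + m)) ≡ 2 * (2 ^ m * 2 ^ m) + m * 2 ^ m
occ-one-two-C zero    = refl
occ-one-two-C (suc m) = begin
  occ one two (C (3 + m))                 ≡⟨ occ-one-two-C-step (suc m) ⟩
  x + (2 * P + x) + 2 * P * (2 * P)       ≡⟨ cong (λ y → y + (2 * P + y) + 2 * P * (2 * P)) (occ-one-two-C m) ⟩
  f + (2 * P + f) + 2 * P * (2 * P)       ≡⟨ closed-form-step P m ⟩
  2 * (2 * P * (2 * P)) + suc m * (2 * P) ∎
  where
  P = 2 ^ m
  x = occ one two (C (2 + m))
  f = 2 * (P * P) + m * P
  closed-form-step : ∀ P m → let f = 2 * (P * P) + m * P in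
    f + (2 * P + f) + 2 * P * (2 * P) ≡ 2 * (2 * P * (2 * P)) + suc m * (2 * P)
  closed-form-step = solve-∀

occ-two-one-from-occ-one-two : ∀ m P w → occ one two w ≡ 2 * (P * P) + m * P →
                               countL one w * countL two w + 2 * P ≡ 2 * P * (2 * P) →
                               occ two one w + (2 + m) * P ≡ 2 * (P * P)
occ-two-one-from-occ-one-two m P w occ-one-two≡ counts = +-cancelʳ-≡ (2 * (P * P)) _ _ (begin
  x + (2 + m) * P + 2 * (P * P)       ≡⟨ shuffle x m P ⟩
  2 * (P * P) + m * P + x + 2 * P     ≡⟨ cong (λ y → y + x + 2 * P) (sym occ-one-two≡) ⟩
  occ one two w + x + 2 * P           ≡⟨ cong (_+ 2 * P) (occ-one-two+occ-two-one w) ⟩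
  countL one w * countL two w + 2 * P ≡⟨ counts ⟩
  2 * P * (2 * P)                     ≡⟨ quadruple P ⟩
  2 * (P * P) + 2 * (P * P)           ∎)
  where
  x = occ two one w
  shuffle : ∀ x m P → x + (2 + m) * P + 2 * (P * P) ≡ 2 * (P * P) + m * P + x + 2 * P
  shuffle = solve-∀
  quadruple : ∀ P → 2 * P * (2 * P) ≡ 2 * (P * P) + 2 * (P * P)
  quadruple = solve-∀

proposition3 : (n : ℕ) → n ≥ 2 →
    (occ one two (C n) ≡ 2 * 4 ^ (n ∸ 2) + (n ∸ 2) * 2 ^ (n ∸ 2))
    × (occ one two (D n) ≡ 2 * 4 ^ (n ∸ 2) + (n ∸ 2) * 2 ^ (n ∸ 2))
    × (occ two one (C n) + n * 2 ^ (n ∸ 2) ≡ 2 * 4 ^ (n ∸ 2))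
    × (occ two one (D n) + n * 2 ^ (n ∸ 2) ≡ 2 * 4 ^ (n ∸ 2))
proposition3 (suc zero) (s≤s ())
proposition3 (suc (suc m)) _ rewrite 4^n≡2^n*2^n m =
    occ-one-two-C m
  , occ-one-two-D
  , occ-two-one-from-occ-one-two m (2 ^ m) (C (2 + m)) (occ-one-two-C m) (countL-one*two-C (suc m))
  , occ-two-one-from-occ-one-two m (2 ^ m) (D (2 + m)) occ-one-two-D (countL-one*two-D (suc m))
  where
  occ-one-two-D : occ one two (D (2 + m)) ≡ 2 * (2 ^ m * 2 ^ m) + m * 2 ^ m
  occ-one-two-D = trans (sym (occ-one-two-C≡D (2 + m))) (occ-one-two-C m)
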